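{- (Dedekind's Theorem.) For all $\gamma\in\omega^\omega$: if $\forall n[q_{\gamma(n)}\le q_{\gamma(n+1)}]$ and $\forall\zeta\in[\omega]^\omega\,\exists n\big[q_{\gamma(\zeta(n))}+\frac{1}{2^n}<q_{\gamma(\zeta(n+1))}\big]$, then $\exists n[1<q_{\gamma(n)}]$.
   Context: Setting: intuitionistic mathematics (intuitionistic logic), assuming the axioms of countable choice and Brouwer's Bar Theorem in the form of Bar Induction: if $B,C\subseteq\omega$, $B$ is a bar in $\omega^\omega$ (i.e. $\forall\alpha\exists n[\langle\alpha(0),\dots,\alpha(n-1)\rangle\in B]$, finite sequences coded by numbers), $B\subseteq C$ and $\forall s[s\in C\leftrightarrow\forall n[s\ast\langle n\rangle\in C]]$, then $\langle\,\rangle\in C$. $q_0,q_1,\dots$ is a fixed enumeration of the rationals $\mathbb{Q}$. $[\omega]^\omega=\{\zeta\in\omega^\omega\mid\forall n[\zeta(n)<\zeta(n+1)]\}$. -}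

module Defs where

open import Data.Nat using (ℕ; zero; suc; _<_)
open import Data.List using (List; []; _∷_; _++_; [_])
open import Data.Product using (Σ; ∃; _×_)
open import Function.Bundles using (_⇔_)
open import Data.Rational using (ℚ; 1ℚ; ½; _*_)
open import Relation.Binary.PropositionalEquality using (_≡_)

-- finite sequences are represented directly as lists (instead of number codes)
-- ⟨ α(0) , … , α(n-1) ⟩
initSeg : (ℕ → ℕ) → ℕ → List ℕ
initSeg α zero = []
initSeg α (suc n) = α 0 ∷ initSeg (λ k → α (suc k)) n

IsBar : (List ℕ → Set) → Set
IsBar B = ∀ (α : ℕ → ℕ) → ∃ λ n → B (initSeg α n)

BarInduction : Set₁
BarInduction = ∀ (B C : List ℕ → Set) → IsBar B →
  (∀ s → B s → C s) →
  (∀ s → C s ⇔ (∀ n → C (s ++ [ n ]))) →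
  C []

StrictInc : (ℕ → ℕ) → Set
StrictInc ζ = ∀ n → ζ n < ζ (suc n)

half^ : ℕ → ℚ
half^ zero = 1ℚ
half^ (suc n) = ½ * half^ n

Surjective : (ℕ → ℚ) → Set
Surjective q = ∀ (r : ℚ) → ∃ λ n → q n ≡ r

-- Write a = q ∘ γ.  It suffices that every value a n is overtaken by 1, i.e. a n + 1 < a m for
-- some m: iterating this and using that ℚ is archimedean gives a value above 1.  This follows by
-- bar induction over finite sequences s of gaps, each coding a finite strictly increasing
-- sequence ζ(0) < … < ζ(j).  Call s good if it already shows a jump a(ζ i) + 2⁻ⁱ < a(ζ(i+1)), or
-- if its last value a(ζ j) is overtaken by 2⁻ʲ.  By hypothesis the nodes showing a jump form a
-- bar.  Goodness is inductive: if all one-point extensions of s are good, then either s is good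
-- or every a u with u > ζ(j) is overtaken by 2⁻⁽ʲ⁺¹⁾, and two such overtakings in a row overtake
-- a(ζ j) by 2⁻ʲ.  Hence the one-point sequence ⟨n⟩ is good, i.e. a n is overtaken by 1.
module Submission where

open import Defs
open import Data.Nat.Base as ℕ using (ℕ; zero; suc; z≤n; s≤s)
import Data.Nat.Properties as ℕ
open import Data.Integer.Base as ℤ using (+_; -[1+_])
import Data.Integer.Properties as ℤ
open import Data.List.Base using (List; []; _∷_; _++_; [_]; length)
open import Data.List.Properties using (++-assoc; ++-identityʳ; length-++-≤ˡ)
open import Data.Product.Base using (∃; _,_; _×_)
open import Data.Sum.Base using (_⊎_; inj₁; inj₂; [_,_]′)
open import Data.Unit.Base using (⊤; tt)
open import Function.Base using (id)
open import Function.Bundles using (mk⇔)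
open import Relation.Binary.PropositionalEquality
  using (_≡_; refl; sym; trans; cong; cong₂; subst; subst₂; module ≡-Reasoning)
open import Data.Rational.Base using (ℚ; mkℚ; 0ℚ; 1ℚ; ½; _+_; _-_; -_; _*_; _<_; _≤_; toℚᵘ)
import Data.Rational.Properties as ℚ
open import Data.Rational.Unnormalised.Base as ℚᵘ using (mkℚᵘ; *≡*; *<*)
import Data.Rational.Unnormalised.Properties as ℚᵘ

fromℕ : ℕ → ℚ
fromℕ zero    = 0ℚ
fromℕ (suc k) = fromℕ k + 1ℚ

toℚᵘ-fromℕ : ∀ k → toℚᵘ (fromℕ k) ℚᵘ.≃ mkℚᵘ (+ k) 0
toℚᵘ-fromℕ zero    = ℚᵘ.≃-refl
toℚᵘ-fromℕ (suc k) = ℚᵘ.≃-trans (ℚ.toℚᵘ-homo-+ (fromℕ k) 1ℚ)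
  (ℚᵘ.≃-trans (ℚᵘ.+-congˡ (toℚᵘ 1ℚ) (toℚᵘ-fromℕ k)) (*≡* k+1≡1+k))
  where
  k+1≡1+k : (+ k ℤ.* + 1 ℤ.+ + 1 ℤ.* + 1) ℤ.* + 1 ≡ + suc k ℤ.* + (1 ℕ.* 1)
  k+1≡1+k rewrite ℤ.*-identityʳ (+ k ℤ.* + 1 ℤ.+ + 1) | ℤ.*-identityʳ (+ k)
                | ℤ.*-identityʳ (+ suc k) = cong +_ (ℕ.+-comm k 1)

i≤+∣i∣ : ∀ i → i ℤ.≤ + ℤ.∣ i ∣
i≤+∣i∣ (+ n)      = ℤ.≤-refl
i≤+∣i∣ -[1+ n ]   = ℤ.-≤+

archimedean : ∀ p → ∃ λ k → p < fromℕ k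
archimedean (mkℚ n d _) = suc ℤ.∣ n ∣ ,
  ℚ.toℚᵘ-cancel-< (ℚᵘ.<-respʳ-≃ (ℚᵘ.≃-sym (toℚᵘ-fromℕ (suc ℤ.∣ n ∣))) (*<* n<∣n∣+1))
  where
  open ℤ.≤-Reasoning
  n<∣n∣+1 : n ℤ.* + 1 ℤ.< + suc ℤ.∣ n ∣ ℤ.* + suc d
  n<∣n∣+1 = begin-strict
    n ℤ.* + 1                    ≡⟨ ℤ.*-identityʳ n ⟩
    n                            ≤⟨ i≤+∣i∣ n ⟩
    + ℤ.∣ n ∣                    <⟨ ℤ.+<+ (ℕ.n<1+n ℤ.∣ n ∣) ⟩
    + suc ℤ.∣ n ∣                ≤⟨ ℤ.+≤+ (ℕ.m≤m*n (suc ℤ.∣ n ∣) (suc d)) ⟩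
    + (suc ℤ.∣ n ∣ ℕ.* suc d)    ≡⟨ ℤ.pos-* (suc ℤ.∣ n ∣) (suc d) ⟩
    + suc ℤ.∣ n ∣ ℤ.* + suc d    ∎

½h+½h≡h : ∀ h → ½ * h + ½ * h ≡ h
½h+½h≡h h = trans (sym (ℚ.*-distribʳ-+ h ½ ½)) (ℚ.*-identityˡ h)

p+[q-p]≡q : ∀ p q → p + (q - p) ≡ q
p+[q-p]≡q p q = begin
  p + (q - p)    ≡⟨ cong (λ r → p + r) (ℚ.+-comm q (- p)) ⟩
  p + (- p + q)  ≡⟨ ℚ.+-assoc p (- p) q ⟨
  p - p + q      ≡⟨ cong (_+ q) (ℚ.+-inverseʳ p) ⟩
  0ℚ + q         ≡⟨ ℚ.+-identityˡ q ⟩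
  q              ∎
  where open ≡-Reasoning

climb : (a : ℕ → ℚ) → (∀ n → ∃ λ m → a n + 1ℚ < a m) → ∀ k → ∃ λ m → a 0 + fromℕ k ≤ a m
climb a step zero    = 0 , ℚ.≤-reflexive (ℚ.+-identityʳ (a 0))
climb a step (suc k) with climb a step k
... | m , a₀+k≤aₘ with step m
... | m′ , aₘ+1<aₘ′ = m′ , ℚ.<⇒≤ (begin-strict
  a 0 + (fromℕ k + 1ℚ)  ≡⟨ ℚ.+-assoc (a 0) (fromℕ k) 1ℚ ⟨
  a 0 + fromℕ k + 1ℚ    ≤⟨ ℚ.+-monoˡ-≤ 1ℚ a₀+k≤aₘ ⟩
  a m + 1ℚ              <⟨ aₘ+1<aₘ′ ⟩
  a m′                  ∎)
  where open ℚ.≤-Reasoning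

unbounded : (a : ℕ → ℚ) → (∀ n → ∃ λ m → a n + 1ℚ < a m) → ∃ λ m → 1ℚ < a m
unbounded a step with archimedean (1ℚ - a 0)
... | k , 1-a₀<k with climb a step k
... | m , a₀+k≤aₘ = m , (begin-strict
  1ℚ                ≡⟨ p+[q-p]≡q (a 0) 1ℚ ⟨
  a 0 + (1ℚ - a 0)  <⟨ ℚ.+-monoʳ-< (a 0) 1-a₀<k ⟩
  a 0 + fromℕ k     ≤⟨ a₀+k≤aₘ ⟩
  a m               ∎)
  where open ℚ.≤-Reasoning

barInduction-monotone : BarInduction → (B C : List ℕ → Set) → IsBar B →
  (∀ s → B s → ∀ t → C (s ++ t)) → (∀ s → (∀ n → C (s ++ [ n ])) → C s) → ∀ s → C s
barInduction-monotone BI B C bar B⊆C closed =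
  BI B C′ bar B⊆C (λ s → mk⇔ (C′-∷ʳ s) (C′-closed s))
  where
  -- C itself need not be closed under extension, but C′ is.
  C′ : List ℕ → Set
  C′ s = ∀ t → C (s ++ t)

  C′-∷ʳ : ∀ s → C′ s → ∀ n → C′ (s ++ [ n ])
  C′-∷ʳ s c n t = subst C (sym (++-assoc s [ n ] t)) (c (n ∷ t))

  C′-closed : ∀ s → (∀ n → C′ (s ++ [ n ])) → C′ s
  C′-closed s c []      = subst C (sym (++-identityʳ s))
    (closed s (λ n → subst C (++-identityʳ (s ++ [ n ])) (c n [])))
  C′-closed s c (n ∷ t) = subst C (++-assoc s [ n ] t) (c n t)

at : List ℕ → ℕ → ℕ
at []       _       = 0
at (x ∷ xs) zero    = x
at (x ∷ xs) (suc j) = at xs j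

at-++ : ∀ s t {j} → j ℕ.< length s → at (s ++ t) j ≡ at s j
at-++ (x ∷ s) t {zero}  _         = refl
at-++ (x ∷ s) t {suc j} (s≤s j<s) = at-++ s t j<s

at-∷ʳ : ∀ s x → at (s ++ [ x ]) (length s) ≡ x
at-∷ʳ []      x = refl
at-∷ʳ (y ∷ s) x = at-∷ʳ s x

at-initSeg : ∀ α {K j} → j ℕ.< K → at (initSeg α K) j ≡ α j
at-initSeg α {suc K} {zero}  _         = refl
at-initSeg α {suc K} {suc j} (s≤s j<K) = at-initSeg (λ k → α (suc k)) j<K

length-initSeg : ∀ α K → length (initSeg α K) ≡ K
length-initSeg α zero    = refl
length-initSeg α (suc K) = cong suc (length-initSeg (λ k → α (suc k)) K)

length-∷ʳ : ∀ (s : List ℕ) x → length (s ++ [ x ]) ≡ suc (length s)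
length-∷ʳ []      x = refl
length-∷ʳ (y ∷ s) x = cong suc (length-∷ʳ s x)

fromGaps : (ℕ → ℕ) → ℕ → ℕ
fromGaps g zero    = g 0
fromGaps g (suc i) = fromGaps g i ℕ.+ suc (g (suc i))

fromGaps-strictInc : ∀ g → StrictInc (fromGaps g)
fromGaps-strictInc g i = ℕ.m<m+n (fromGaps g i) (s≤s z≤n)

fromGaps-local : ∀ {g h} i → (∀ {j} → j ℕ.≤ i → g j ≡ h j) → fromGaps g i ≡ fromGaps h i
fromGaps-local zero    g≡h = g≡h z≤n
fromGaps-local (suc i) g≡h =
  cong₂ (λ m n → m ℕ.+ suc n) (fromGaps-local i (λ j≤i → g≡h (ℕ.m≤n⇒m≤1+n j≤i))) (g≡h ℕ.≤-refl)

-- The node s codes the first length s values of points s.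
points : List ℕ → ℕ → ℕ
points s = fromGaps (at s)

points-++ : ∀ s t {i} → i ℕ.< length s → points (s ++ t) i ≡ points s i
points-++ s t {i} i<s = fromGaps-local i (λ j≤i → at-++ s t (ℕ.≤-<-trans j≤i i<s))

points-initSeg : ∀ α {K i} → i ℕ.< K → points (initSeg α K) i ≡ fromGaps α i
points-initSeg α {i = i} i<K = fromGaps-local i (λ j≤i → at-initSeg α (ℕ.≤-<-trans j≤i i<K))

points-∷ʳ : ∀ x xs y →
  points (x ∷ xs ++ [ y ]) (suc (length xs)) ≡ points (x ∷ xs) (length xs) ℕ.+ suc y
points-∷ʳ x xs y =
  cong₂ (λ m n → m ℕ.+ suc n) (points-++ (x ∷ xs) [ y ] (ℕ.n<1+n (length xs))) (at-∷ʳ xs y)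

module _ (a : ℕ → ℚ) where

  Jump : (ℕ → ℕ) → ℕ → Set
  Jump ζ n = a (ζ n) + half^ n < a (ζ (suc n))

  Overtaken : ℚ → ℕ → Set
  Overtaken h u = ∃ λ m → u ℕ.< m × a u + h < a m

  jump-cong : ∀ ζ ξ {n} → ζ n ≡ ξ n → ζ (suc n) ≡ ξ (suc n) → Jump ζ n → Jump ξ n
  jump-cong _ _ {n} = subst₂ (λ u v → a u + half^ n < a v)

  -- Only two instances are needed: u = P + 1, and then the index reached from it.
  overtaken-by-halves : ∀ {X : Set} {h P} → a P ≤ a (suc P) →
    (∀ u → P ℕ.< u → X ⊎ Overtaken (½ * h) u) → X ⊎ Overtaken h P
  overtaken-by-halves {h = h} {P} aP≤aP+1 overtaken with overtaken (suc P) ℕ.≤-refl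
  ... | inj₁ x = inj₁ x
  ... | inj₂ (m₁ , P+1<m₁ , jump₁) with overtaken m₁ (ℕ.<-trans (ℕ.n<1+n P) P+1<m₁)
  ... | inj₁ x = inj₁ x
  ... | inj₂ (m₂ , m₁<m₂ , jump₂) =
    inj₂ (m₂ , ℕ.<-trans (ℕ.n<1+n P) (ℕ.<-trans P+1<m₁ m₁<m₂) , (begin-strict
      a P + h                  ≡⟨ cong (λ r → a P + r) (½h+½h≡h h) ⟨
      a P + (½ * h + ½ * h)    ≡⟨ ℚ.+-assoc (a P) (½ * h) (½ * h) ⟨
      a P + ½ * h + ½ * h      ≤⟨ ℚ.+-monoˡ-≤ (½ * h) (ℚ.+-monoˡ-≤ (½ * h) aP≤aP+1) ⟩
      a (suc P) + ½ * h + ½ * h <⟨ ℚ.+-monoˡ-< (½ * h) jump₁ ⟩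
      a m₁ + ½ * h             <⟨ jump₂ ⟩
      a m₂                     ∎))
    where open ℚ.≤-Reasoning

  HasJump : List ℕ → Set
  HasJump s = ∃ λ n → suc n ℕ.< length s × Jump (points s) n

  LastOvertaken : List ℕ → Set
  LastOvertaken []       = ⊤
  LastOvertaken (x ∷ xs) = Overtaken (half^ (length xs)) (points (x ∷ xs) (length xs))

  Good : List ℕ → Set
  Good s = HasJump s ⊎ LastOvertaken s

  hasJump-++ : ∀ s → HasJump s → ∀ t → HasJump (s ++ t)
  hasJump-++ s (n , n+1<s , jump) t =
    n , ℕ.<-≤-trans n+1<s (length-++-≤ˡ s) ,
    jump-cong (points s) (points (s ++ t))
      (sym (points-++ s t (ℕ.<-trans (ℕ.n<1+n n) n+1<s))) (sym (points-++ s t n+1<s)) jump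

  hasJump-isBar : (∀ ζ → StrictInc ζ → ∃ (Jump ζ)) → IsBar HasJump
  hasJump-isBar jumps α with jumps (fromGaps α) (fromGaps-strictInc α)
  ... | n , jump = suc (suc n) , n , ℕ.≤-reflexive (sym (length-initSeg α (suc (suc n)))) ,
    jump-cong (fromGaps α) (points (initSeg α (suc (suc n))))
      (sym (points-initSeg α (ℕ.<-trans (ℕ.n<1+n n) (ℕ.n<1+n (suc n)))))
      (sym (points-initSeg α (ℕ.n<1+n (suc n)))) jump

  good-∷ʳ : ∀ x xs y → Good (x ∷ xs ++ [ y ]) →
    Good (x ∷ xs) ⊎ Overtaken (½ * half^ (length xs)) (points (x ∷ xs) (length xs) ℕ.+ suc y)
  good-∷ʳ x xs y (inj₁ (n , n+1<s+1 , jump))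
    with ℕ.m≤n⇒m<n∨m≡n (ℕ.≤-pred (ℕ.≤-pred (subst (suc n ℕ.<_) (length-∷ʳ (x ∷ xs) y) n+1<s+1)))
  ... | inj₁ n<j = inj₁ (inj₁ (n , s≤s n<j ,
    jump-cong (points (x ∷ xs ++ [ y ])) (points (x ∷ xs))
      (points-++ (x ∷ xs) [ y ] (ℕ.<-trans n<j (ℕ.n<1+n _))) (points-++ (x ∷ xs) [ y ] (s≤s n<j))
      jump))
  ... | inj₂ refl = inj₁ (inj₂ (points (x ∷ xs) n ℕ.+ suc y , ℕ.m<m+n _ (s≤s z≤n) ,
    subst₂ (λ u v → a u + half^ n < a v)
      (points-++ (x ∷ xs) [ y ] (ℕ.n<1+n n)) (points-∷ʳ x xs y) jump))
  good-∷ʳ x xs y (inj₂ overtaken) =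
    inj₂ (subst (Overtaken _) (points-∷ʳ x xs y)
      (subst (λ j → Overtaken (half^ j) (points (x ∷ xs ++ [ y ]) j)) (length-∷ʳ xs y) overtaken))

  good-closed : (∀ n → a n ≤ a (suc n)) → ∀ s → (∀ y → Good (s ++ [ y ])) → Good s
  good-closed mono []       _    = inj₂ tt
  good-closed mono (x ∷ xs) good = [ id , inj₂ ]′ (overtaken-by-halves (mono P) beyond)
    where
    P : ℕ
    P = points (x ∷ xs) (length xs)

    beyond : ∀ u → P ℕ.< u → Good (x ∷ xs) ⊎ Overtaken (½ * half^ (length xs)) u
    beyond u P<u = subst (λ v → Good (x ∷ xs) ⊎ Overtaken _ v) P+[u-P]≡u (good-∷ʳ x xs y (good y))
      where
      y : ℕ
      y = u ℕ.∸ suc P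
      P+[u-P]≡u : P ℕ.+ suc y ≡ u
      P+[u-P]≡u = trans (ℕ.+-suc P y) (ℕ.m+[n∸m]≡n P<u)

  overtaken-by-one : BarInduction → (∀ n → a n ≤ a (suc n)) →
    (∀ ζ → StrictInc ζ → ∃ (Jump ζ)) → ∀ n → ∃ λ m → a n + 1ℚ < a m
  overtaken-by-one BI mono jumps n
    with barInduction-monotone BI HasJump Good (hasJump-isBar jumps)
           (λ s b t → inj₁ (hasJump-++ s b t)) (good-closed mono) [ n ]
  ... | inj₁ (_ , s≤s () , _)
  ... | inj₂ (m , _ , aₙ+1<aₘ) = m , aₙ+1<aₘ

theorem7p12 : BarInduction → (q : ℕ → ℚ) → Surjective q →
    (γ : ℕ → ℕ) →
    (∀ n → q (γ n) ≤ q (γ (suc n))) →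
    (∀ (ζ : ℕ → ℕ) → StrictInc ζ → ∃ λ n → q (γ (ζ n)) + half^ n < q (γ (ζ (suc n)))) →
    ∃ λ n → 1ℚ < q (γ n)
theorem7p12 BI q _ γ mono jumps =
  unbounded (λ i → q (γ i)) (overtaken-by-one (λ i → q (γ i)) BI mono jumps)
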